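{- Let $m\ge 3$ be an odd integer and $n>3$ an integer. Then $\operatorname{def}(T_{m,n})=(n-1)(n-2)^{\frac{m-3}{2}}-1$.
   Context: The deficiency $\operatorname{def}(G)$ of a graph $G$ is the number of vertices not saturated by a maximum matching of $G$. The tree $T_{m,n}$ is defined as follows. $T_{3,n}=K_{1,n-1}$. For odd $m\ge 5$, $T_{m,n}$ is a rooted tree whose vertices are partitioned into levels $L_0,L_1,\dots,L_{m-2}$ according to their distance from the root ($L_0$ consists of the root), in which: the vertices of degree $1$ are exactly those of $L_{m-2}$; the vertices of degree $2$ are exactly those of $L_1\cup L_3\cup\dots\cup L_{m-4}$; and the vertices of degree $n-1$ are exactly those of $L_0\cup L_2\cup\dots\cup L_{m-3}$ (and these are all the vertices). -}

module Defs where

open import Data.Nat using (ℕ; zero; suc; _+_; _*_; _∸_; _^_; _≤_)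
open import Data.Nat.DivMod using (_/_)
open import Data.Fin using (Fin; toℕ)
open import Data.Fin.Properties using () renaming (_≟_ to _≟ᶠ_)
open import Data.List using (List; []; _∷_; _++_; length; concatMap; filter; replicate; [_])
open import Data.List.Relation.Unary.All using (All)
open import Data.List.Relation.Unary.Unique.Propositional using (Unique)
open import Data.List.Membership.Propositional using (_∈_)
open import Data.Product using (Σ; _×_; _,_; proj₁; proj₂)
open import Data.Sum using (_⊎_)
open import Relation.Nullary using (¬?)
open import Relation.Binary.PropositionalEquality using (_≡_)
import Data.List.Membership.DecPropositional as DecMem
open import Data.List using (allFin)

record Graph : Set₁ where
  field
    N   : ℕ
    Adj : Fin N → Fin N → Set

open Graph public

endpoints : {N : ℕ} → List (Fin N × Fin N) → List (Fin N)
endpoints = concatMap (λ e → proj₁ e ∷ proj₂ e ∷ [])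

-- A matching: a list of edges of G, pairwise vertex-disjoint
-- (all endpoints distinct; in particular no loops, no repeated edge).
record Matching (G : Graph) : Set where
  field
    edges    : List (Fin (N G) × Fin (N G))
    areEdges : All (λ e → Adj G (proj₁ e) (proj₂ e)) edges
    disjoint : Unique (endpoints edges)

open Matching public

∣_∣ₘ : {G : Graph} → Matching G → ℕ
∣ M ∣ₘ = length (edges M)

IsMaximum : {G : Graph} → Matching G → Set
IsMaximum {G} M = (M' : Matching G) → ∣ M' ∣ₘ ≤ ∣ M ∣ₘ

unsaturated : {G : Graph} → Matching G → ℕ
unsaturated {G} M =
  length (filter (λ v → ¬? (v ∈? endpoints (edges M))) (allFin (N G)))
  where open DecMem (_≟ᶠ_ {N G}) using (_∈?_)

-- def(G) = d : d is the number of vertices not saturated by a maximum matching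
-- (this number is the same for all maximum matchings).
IsDeficiency : Graph → ℕ → Set
IsDeficiency G d = Σ (Matching G) (λ M → IsMaximum M × unsaturated M ≡ d)

data RTree : Set where
  node : List RTree → RTree

leaf : RTree
leaf = node []

mutual
  size : RTree → ℕ
  size (node ts) = suc (sizes ts)

  sizes : List RTree → ℕ
  sizes []       = 0
  sizes (t ∷ ts) = size t + sizes ts

-- Vertices are numbered in preorder starting from the given offset;
-- the edges are the parent–child pairs.
mutual
  treeEdges : ℕ → RTree → List (ℕ × ℕ)
  treeEdges o (node ts) = childEdges o (suc o) ts

  childEdges : ℕ → ℕ → List RTree → List (ℕ × ℕ)
  childEdges p q []       = []
  childEdges p q (t ∷ ts) = (p , q) ∷ (treeEdges q t ++ childEdges p (q + size t) ts)

treeGraph : RTree → Graph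
treeGraph t = record
  { N   = size t
  ; Adj = λ u v → ((toℕ u , toℕ v) ∈ treeEdges 0 t) ⊎ ((toℕ v , toℕ u) ∈ treeEdges 0 t)
  }

-- The tree T_{m,n}, m = 2k+3 odd.
-- C n j : subtree rooted at a vertex of an even level L_{2i} (i ≥ 1),
-- which has n-2 children; j = number of degree-2 levels still below it.
C : ℕ → ℕ → RTree
C n zero    = node (replicate (n ∸ 2) leaf)
C n (suc j) = node (replicate (n ∸ 2) (node [ C n j ]))

-- Tk n k = T_{2k+3, n}
Tk : ℕ → ℕ → RTree
Tk n zero    = node (replicate (n ∸ 1) leaf)
Tk n (suc k) = node (replicate (n ∸ 1) (node [ C n k ]))

-- T_{m,n} (meaningful for odd m ≥ 3)
T : ℕ → ℕ → Graph
T m n = treeGraph (Tk n ((m ∸ 3) / 2))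

{-# OPTIONS --safe #-}

-- In a rooted tree, matching every vertex of even depth with its first child gives a
-- matching, and the vertices of even depth cover every edge.  If no vertex of even depth
-- is a leaf, the matching and the cover have the same size, so the matching is maximum
-- (the easy half of König's theorem) and the deficiency is #odd − #even.  In T_{m,n} all
-- leaves lie on the odd level m − 2, and counting the levels with k = (m − 3)/2 gives
-- #odd − #even = (n − 1)(n − 2)^k − 1.

module Submission where

open import Defs
open import Data.Nat using (ℕ; _≤_; _<_; _*_; _∸_; _^_)
open import Data.Nat.DivMod using (_/_; _%_)
open import Relation.Binary.PropositionalEquality using (_≡_)

open import Data.Nat using (zero; suc; _+_; z≤n; s≤s)
open import Data.Nat.Properties
  using (≤-refl; <⇒≤; <⇒≢; ≤-antisym; +-comm; +-suc; +-assoc; +-identityʳ; *-suc; *-identityʳ;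
         m+n∸n≡m; [m+n]∸[m+o]≡n∸o; module ≤-Reasoning)
open import Data.Nat.Tactic.RingSolver using (solve-∀)
open import Data.Fin using (Fin; toℕ; fromℕ<)
open import Data.Fin.Properties using (toℕ-injective; toℕ-fromℕ<) renaming (_≟_ to _≟ᶠ_)
open import Data.List using (List; []; _∷_; _++_; length; map; concatMap; filter; replicate; [_]; allFin)
open import Data.List.Properties using (length-map; length-++; length-tabulate; length-removeAt′; concatMap-++)
open import Data.List.Relation.Unary.All as All using (All; []; _∷_)
import Data.List.Relation.Unary.All.Properties as All
open import Data.List.Relation.Unary.Any using (here; there; index; _─_)
open import Data.List.Relation.Unary.Unique.Propositional using (Unique; []; _∷_)
import Data.List.Relation.Unary.Unique.Propositional.Properties as Unique
open import Data.List.Relation.Binary.Subset.Propositional using (_⊆_)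
open import Data.List.Relation.Binary.Subset.Propositional.Properties using (⊆-trans; ++⁺; xs⊆x∷xs; ∈-∷⁺ʳ)
open import Data.List.Relation.Binary.Sublist.Propositional using ([]; _∷_; _∷ʳ_) renaming (_⊆_ to _⊑_)
import Data.List.Relation.Binary.Sublist.Propositional.Properties as Sublist
open import Data.List.Membership.Propositional using (_∈_)
open import Data.List.Membership.Propositional.Properties using (∈-++⁺ˡ; ∈-++⁺ʳ; ∈-++⁻; ∈-filter⁺; ∈-filter⁻; ∈-allFin)
import Data.List.Membership.DecPropositional as DecMembership
open import Data.Parity.Base using (Parity; 0ℙ; 1ℙ)
open import Data.Product using (Σ-syntax; _×_; _,_; proj₁; proj₂)
open import Data.Sum as Sum using (_⊎_; inj₁; inj₂)
open import Data.Empty using (⊥-elim)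
open import Function using (id)
open import Relation.Nullary using (yes; no; ¬?)
open import Relation.Unary using (Decidable)
open import Relation.Unary.Properties using (∁?)
open import Relation.Binary.Definitions using (DecidableEquality)
open import Relation.Binary.PropositionalEquality
  using (refl; sym; trans; cong; cong₂; subst; subst₂; _≢_; module ≡-Reasoning)

module _ {A : Set} where

  -- `endpoints` for an arbitrary vertex type (definitionally equal to it on Fin).
  ends : List (A × A) → List A
  ends = concatMap (λ e → proj₁ e ∷ proj₂ e ∷ [])

  length-ends : (es : List (A × A)) → length (ends es) ≡ 2 * length es
  length-ends []       = refl
  length-ends (_ ∷ es) = trans (cong (2 +_) (length-ends es)) (sym (*-suc 2 (length es)))

  ∈-─ : ∀ {x y : A} {ys} (x∈ys : x ∈ ys) → y ∈ ys → x ≢ y → y ∈ (ys ─ x∈ys)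
  ∈-─ (here refl)  (here refl)  x≢y = ⊥-elim (x≢y refl)
  ∈-─ (here _)     (there y∈ys) _   = y∈ys
  ∈-─ (there _)    (here y≡z)   _   = here y≡z
  ∈-─ (there x∈ys) (there y∈ys) x≢y = there (∈-─ x∈ys y∈ys x≢y)

  pigeonhole : ∀ {xs ys : List A} → Unique xs → xs ⊆ ys → length xs ≤ length ys
  pigeonhole []                            _       = z≤n
  pigeonhole {x ∷ xs} {ys} (x≢xs ∷ xs!) x∷xs⊆ys = begin
    suc (length xs)          ≤⟨ s≤s (pigeonhole xs! xs⊆ys─x) ⟩
    suc (length (ys ─ x∈ys)) ≡⟨ sym (length-removeAt′ ys (index x∈ys)) ⟩
    length ys                ∎
    where
      open ≤-Reasoning
      x∈ys : x ∈ ys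
      x∈ys = x∷xs⊆ys (here refl)
      xs⊆ys─x : xs ⊆ (ys ─ x∈ys)
      xs⊆ys─x y∈xs = ∈-─ x∈ys (x∷xs⊆ys (there y∈xs)) (All.lookup x≢xs y∈xs)

  Unique-resp-⊑ : ∀ {xs ys : List A} → xs ⊑ ys → Unique ys → Unique xs
  Unique-resp-⊑ []             []           = []
  Unique-resp-⊑ (_ ∷ʳ xs⊑ys)   (_ ∷ ys!)    = Unique-resp-⊑ xs⊑ys ys!
  Unique-resp-⊑ (refl ∷ xs⊑ys) (y≢ys ∷ ys!) = Sublist.All-resp-⊆ xs⊑ys y≢ys ∷ Unique-resp-⊑ xs⊑ys ys!

  length-filter-∁ : ∀ {P : A → Set} (P? : Decidable P) xs →
    length (filter P? xs) + length (filter (∁? P?) xs) ≡ length xs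
  length-filter-∁ P? []       = refl
  length-filter-∁ P? (x ∷ xs) with P? x
  ... | yes _ = cong suc (length-filter-∁ P? xs)
  ... | no  _ = trans (+-suc _ _) (cong suc (length-filter-∁ P? xs))

  module _ (_≟_ : DecidableEquality A) where
    open DecMembership _≟_ using (_∈?_)

    length-filter-∉ : ∀ {xs E} → Unique xs → Unique E → E ⊆ xs →
      length (filter (λ v → ¬? (v ∈? E)) xs) + length E ≡ length xs
    length-filter-∉ {xs} {E} xs! E! E⊆xs = begin
      length outside + length E       ≡⟨ cong (length outside +_) (sym length-inside) ⟩
      length outside + length inside  ≡⟨ +-comm (length outside) (length inside) ⟩
      length inside + length outside  ≡⟨ length-filter-∁ (_∈? E) xs ⟩
      length xs                       ∎
      where
        open ≡-Reasoning
        inside outside : List A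
        inside  = filter (_∈? E) xs
        outside = filter (∁? (_∈? E)) xs
        length-inside : length inside ≡ length E
        length-inside = ≤-antisym
          (pigeonhole (Unique.filter⁺ (_∈? E) xs!) (λ v∈ → proj₂ (∈-filter⁻ (_∈? E) {xs = xs} v∈)))
          (pigeonhole E! (λ v∈E → ∈-filter⁺ (_∈? E) (E⊆xs v∈E) v∈E))

module _ {A : Set} {P : A → Set} where

  pick : (es : List (A × A)) → All (λ e → P (proj₁ e) ⊎ P (proj₂ e)) es → List A
  pick []             []            = []
  pick ((u , _) ∷ es) (inj₁ _ ∷ hs) = u ∷ pick es hs
  pick ((_ , v) ∷ es) (inj₂ _ ∷ hs) = v ∷ pick es hs

  length-pick : ∀ es hs → length (pick es hs) ≡ length es
  length-pick []       []            = refl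
  length-pick (_ ∷ es) (inj₁ _ ∷ hs) = cong suc (length-pick es hs)
  length-pick (_ ∷ es) (inj₂ _ ∷ hs) = cong suc (length-pick es hs)

  All-pick : ∀ es hs → All P (pick es hs)
  All-pick []       []             = []
  All-pick (_ ∷ es) (inj₁ pu ∷ hs) = pu ∷ All-pick es hs
  All-pick (_ ∷ es) (inj₂ pv ∷ hs) = pv ∷ All-pick es hs

  pick-⊑-ends : ∀ es hs → pick es hs ⊑ ends es
  pick-⊑-ends []             []            = []
  pick-⊑-ends ((_ , v) ∷ es) (inj₁ _ ∷ hs) = refl ∷ (v ∷ʳ pick-⊑-ends es hs)
  pick-⊑-ends ((u , _) ∷ es) (inj₂ _ ∷ hs) = u ∷ʳ (refl ∷ pick-⊑-ends es hs)

Touches : List ℕ → ℕ × ℕ → Set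
Touches C (x , y) = x ∈ C ⊎ y ∈ C

Covers : Graph → List ℕ → Set
Covers G C = ∀ {u v} → Adj G u v → Touches C (toℕ u , toℕ v)

module _ {G : Graph} where

  matching≤cover : (M : Matching G) {C : List ℕ} → Covers G C → ∣ M ∣ₘ ≤ length C
  matching≤cover M {C} covers = begin
    ∣ M ∣ₘ                ≡⟨ sym (length-pick (edges M) coveredEnds) ⟩
    length picked         ≡⟨ sym (length-map toℕ picked) ⟩
    length (map toℕ picked) ≤⟨ pigeonhole picked! (All.lookup (All.map⁺ (All-pick (edges M) coveredEnds))) ⟩
    length C              ∎
    where
      open ≤-Reasoning
      coveredEnds : All (λ e → Touches C (toℕ (proj₁ e) , toℕ (proj₂ e))) (edges M)
      coveredEnds = All.map covers (areEdges M)
      picked : List (Fin (N G))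
      picked = pick (edges M) coveredEnds
      picked! : Unique (map toℕ picked)
      picked! = Unique.map⁺ toℕ-injective
        (Unique-resp-⊑ (pick-⊑-ends (edges M) coveredEnds) (disjoint M))

  unsaturated+2∣M∣≡N : (M : Matching G) → unsaturated M + 2 * ∣ M ∣ₘ ≡ N G
  unsaturated+2∣M∣≡N M = begin
    unsaturated M + 2 * ∣ M ∣ₘ                   ≡⟨ cong (unsaturated M +_) (sym (length-ends (edges M))) ⟩
    unsaturated M + length (endpoints (edges M)) ≡⟨ length-filter-∉ _≟ᶠ_ (Unique.allFin⁺ _) (disjoint M) (λ {v} _ → ∈-allFin v) ⟩
    length (allFin (N G))                        ≡⟨ length-tabulate id ⟩
    N G                                          ∎
    where open ≡-Reasoning

  isDeficiency-of-cover : (M : Matching G) {C : List ℕ} → Covers G C → ∣ M ∣ₘ ≡ length C →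
    IsDeficiency G (N G ∸ 2 * ∣ M ∣ₘ)
  isDeficiency-of-cover M covers ∣M∣≡∣C∣ =
    M , maximum , trans (sym (m+n∸n≡m _ (2 * ∣ M ∣ₘ))) (cong (_∸ 2 * ∣ M ∣ₘ) (unsaturated+2∣M∣≡N M))
    where
      maximum : IsMaximum M
      maximum M′ = subst (∣ M′ ∣ₘ ≤_) (sym ∣M∣≡∣C∣) (matching≤cover M′ covers)

-- Vertices are named by their preorder labels as in treeEdges: o (q) is the label of the
-- root of t (of the first tree of ts).
mutual
  vertices : ℕ → RTree → List ℕ
  vertices o (node ts) = o ∷ forestVertices (suc o) ts

  forestVertices : ℕ → List RTree → List ℕ
  forestVertices q []       = []
  forestVertices q (t ∷ ts) = vertices q t ++ forestVertices (q + size t) ts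

data Consecutive : ℕ → List ℕ → ℕ → Set where
  []   : ∀ {n} → Consecutive n [] n
  _∷_  : ∀ m {xs n} → Consecutive (suc m) xs n → Consecutive m (m ∷ xs) n

Consecutive-++ : ∀ {l m n xs ys} → Consecutive l xs m → Consecutive m ys n → Consecutive l (xs ++ ys) n
Consecutive-++ []       ys = ys
Consecutive-++ (x ∷ xs) ys = x ∷ Consecutive-++ xs ys

Consecutive⇒≤ : ∀ {m xs n} → Consecutive m xs n → m ≤ n
Consecutive⇒≤ []       = ≤-refl
Consecutive⇒≤ (_ ∷ xs) = <⇒≤ (Consecutive⇒≤ xs)

Consecutive⇒< : ∀ {m xs n} → Consecutive m xs n → All (_< n) xs
Consecutive⇒< []       = []
Consecutive⇒< (_ ∷ xs) = Consecutive⇒≤ xs ∷ Consecutive⇒< xs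

Consecutive⇒> : ∀ {m xs n} → Consecutive (suc m) xs n → All (m <_) xs
Consecutive⇒> []       = []
Consecutive⇒> (_ ∷ xs) = ≤-refl ∷ All.map <⇒≤ (Consecutive⇒> xs)

Consecutive⇒Unique : ∀ {m xs n} → Consecutive m xs n → Unique xs
Consecutive⇒Unique []       = []
Consecutive⇒Unique (_ ∷ xs) = All.map <⇒≢ (Consecutive⇒> xs) ∷ Consecutive⇒Unique xs

mutual
  vertices-consecutive : ∀ o t → Consecutive o (vertices o t) (o + size t)
  vertices-consecutive o (node ts) =
    subst (Consecutive o _) (sym (+-suc o (sizes ts))) (o ∷ forestVertices-consecutive (suc o) ts)

  forestVertices-consecutive : ∀ q ts → Consecutive q (forestVertices q ts) (q + sizes ts)
  forestVertices-consecutive q []       = subst (Consecutive q []) (sym (+-identityʳ q)) []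
  forestVertices-consecutive q (t ∷ ts) = subst (Consecutive q _) (+-assoc q (size t) (sizes ts))
    (Consecutive-++ (vertices-consecutive q t) (forestVertices-consecutive (q + size t) ts))

module _ {n : ℕ} where

  toFinEdges : (es : List (ℕ × ℕ)) → All (_< n) (ends es) → List (Fin n × Fin n)
  toFinEdges []       []                 = []
  toFinEdges (_ ∷ es) (x<n ∷ y<n ∷ ends<n) = (fromℕ< x<n , fromℕ< y<n) ∷ toFinEdges es ends<n

  length-toFinEdges : ∀ es ends<n → length (toFinEdges es ends<n) ≡ length es
  length-toFinEdges []       []              = refl
  length-toFinEdges (_ ∷ es) (_ ∷ _ ∷ ends<n) = cong suc (length-toFinEdges es ends<n)

  ends-toFinEdges : ∀ es ends<n → map toℕ (ends (toFinEdges es ends<n)) ≡ ends es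
  ends-toFinEdges []       []                 = refl
  ends-toFinEdges (_ ∷ es) (x<n ∷ y<n ∷ ends<n) =
    cong₂ _∷_ (toℕ-fromℕ< x<n) (cong₂ _∷_ (toℕ-fromℕ< y<n) (ends-toFinEdges es ends<n))

  All-toFinEdges : {R : ℕ → ℕ → Set} → ∀ es ends<n → All (λ e → R (proj₁ e) (proj₂ e)) es →
    All (λ e → R (toℕ (proj₁ e)) (toℕ (proj₂ e))) (toFinEdges es ends<n)
  All-toFinEdges {R} []       []                 []         = []
  All-toFinEdges {R} (_ ∷ es) (x<n ∷ y<n ∷ ends<n) (r ∷ rs) =
    subst₂ R (sym (toℕ-fromℕ< x<n)) (sym (toℕ-fromℕ< y<n)) r ∷ All-toFinEdges es ends<n rs

treeMatching : (t : RTree) (es : List (ℕ × ℕ)) → es ⊆ treeEdges 0 t →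
  Unique (ends es) → All (_< size t) (ends es) → Σ[ M ∈ Matching (treeGraph t) ] ∣ M ∣ₘ ≡ length es
treeMatching t es es⊆ es! ends<n = M , length-toFinEdges es ends<n
  where
    M : Matching (treeGraph t)
    M = record
      { edges    = toFinEdges es ends<n
      ; areEdges = All.map inj₁ (All-toFinEdges es ends<n (All.tabulate es⊆))
      ; disjoint = Unique.map⁻ (subst Unique (sym (ends-toFinEdges es ends<n)) es!)
      }

-- A Parity argument is the parity of the depth of the root of t (of the roots of ts) in an
-- ambient tree, and "even" refers to that ambient depth.
mutual
  evenVertices : Parity → ℕ → RTree → List ℕ
  evenVertices 0ℙ o (node ts) = o ∷ forestEvenVertices 1ℙ (suc o) ts
  evenVertices 1ℙ o (node ts) = forestEvenVertices 0ℙ (suc o) ts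

  forestEvenVertices : Parity → ℕ → List RTree → List ℕ
  forestEvenVertices p q []       = []
  forestEvenVertices p q (t ∷ ts) = evenVertices p q t ++ forestEvenVertices p (q + size t) ts

mutual
  evenCount : Parity → RTree → ℕ
  evenCount 0ℙ (node ts) = suc (forestEvenCount 1ℙ ts)
  evenCount 1ℙ (node ts) = forestEvenCount 0ℙ ts

  forestEvenCount : Parity → List RTree → ℕ
  forestEvenCount p []       = 0
  forestEvenCount p (t ∷ ts) = evenCount p t + forestEvenCount p ts

mutual
  length-evenVertices : ∀ p o t → length (evenVertices p o t) ≡ evenCount p t
  length-evenVertices 0ℙ o (node ts) = cong suc (length-forestEvenVertices 1ℙ (suc o) ts)
  length-evenVertices 1ℙ o (node ts) = length-forestEvenVertices 0ℙ (suc o) ts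

  length-forestEvenVertices : ∀ p q ts → length (forestEvenVertices p q ts) ≡ forestEvenCount p ts
  length-forestEvenVertices p q []       = refl
  length-forestEvenVertices p q (t ∷ ts) = trans (length-++ (evenVertices p q t))
    (cong₂ _+_ (length-evenVertices p q t) (length-forestEvenVertices p (q + size t) ts))

mutual
  evenVertices-touch : ∀ p o t {e} → e ∈ treeEdges o t → Touches (evenVertices p o t) e
  evenVertices-touch 0ℙ o (node ts) e∈ with oddChildEdges-touch o (suc o) ts e∈
  ... | inj₁ x≡o   = inj₁ (here x≡o)
  ... | inj₂ touch = Sum.map there there touch
  evenVertices-touch 1ℙ o (node ts) e∈ = evenChildEdges-touch o (suc o) ts e∈

  oddChildEdges-touch : ∀ r q ts {e} → e ∈ childEdges r q ts →
    proj₁ e ≡ r ⊎ Touches (forestEvenVertices 1ℙ q ts) e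
  oddChildEdges-touch r q (t ∷ ts) (here refl) = inj₁ refl
  oddChildEdges-touch r q (t ∷ ts) (there e∈) with ∈-++⁻ (treeEdges q t) e∈
  ... | inj₁ e∈t  = inj₂ (Sum.map ∈-++⁺ˡ ∈-++⁺ˡ (evenVertices-touch 1ℙ q t e∈t))
  ... | inj₂ e∈ts = Sum.map₂ (Sum.map (∈-++⁺ʳ _) (∈-++⁺ʳ _)) (oddChildEdges-touch r (q + size t) ts e∈ts)

  evenChildEdges-touch : ∀ r q ts {e} → e ∈ childEdges r q ts → Touches (forestEvenVertices 0ℙ q ts) e
  evenChildEdges-touch r q (node _ ∷ ts) (here refl) = inj₂ (here refl)
  evenChildEdges-touch r q (t ∷ ts) (there e∈) with ∈-++⁻ (treeEdges q t) e∈
  ... | inj₁ e∈t  = Sum.map ∈-++⁺ˡ ∈-++⁺ˡ (evenVertices-touch 0ℙ q t e∈t)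
  ... | inj₂ e∈ts = Sum.map (∈-++⁺ʳ _) (∈-++⁺ʳ _) (evenChildEdges-touch r (q + size t) ts e∈ts)

evenVertices-cover : ∀ t → Covers (treeGraph t) (evenVertices 0ℙ 0 t)
evenVertices-cover t (inj₁ uv∈) = evenVertices-touch 0ℙ 0 t uv∈
evenVertices-cover t (inj₂ vu∈) = Sum.swap (evenVertices-touch 0ℙ 0 t vu∈)

mutual
  firstChildMatching : Parity → ℕ → RTree → List (ℕ × ℕ)
  firstChildMatching 0ℙ o (node [])         = []
  firstChildMatching 0ℙ o (node ts@(_ ∷ _)) = (o , suc o) ∷ forestFirstChildMatching 1ℙ (suc o) ts
  firstChildMatching 1ℙ o (node ts)         = forestFirstChildMatching 0ℙ (suc o) ts

  forestFirstChildMatching : Parity → ℕ → List RTree → List (ℕ × ℕ)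
  forestFirstChildMatching p q []       = []
  forestFirstChildMatching p q (t ∷ ts) =
    firstChildMatching p q t ++ forestFirstChildMatching p (q + size t) ts

mutual
  firstChildMatching-⊆ : ∀ p o t → firstChildMatching p o t ⊆ treeEdges o t
  firstChildMatching-⊆ 0ℙ o (node [])         ()
  firstChildMatching-⊆ 0ℙ o (node ts@(_ ∷ _)) = ∈-∷⁺ʳ (here refl) (forestFirstChildMatching-⊆ 1ℙ o (suc o) ts)
  firstChildMatching-⊆ 1ℙ o (node ts)         = forestFirstChildMatching-⊆ 0ℙ o (suc o) ts

  forestFirstChildMatching-⊆ : ∀ p r q ts → forestFirstChildMatching p q ts ⊆ childEdges r q ts
  forestFirstChildMatching-⊆ p r q []       ()
  forestFirstChildMatching-⊆ p r q (t ∷ ts) = ⊆-trans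
    (++⁺ (firstChildMatching-⊆ p q t) (forestFirstChildMatching-⊆ p r (q + size t) ts))
    (xs⊆x∷xs _ (r , q))

ends-++⁺ : ∀ {A : Set} (xs : List (A × A)) {ys us vs} → ends xs ⊑ us → ends ys ⊑ vs → ends (xs ++ ys) ⊑ us ++ vs
ends-++⁺ xs {ys} xs⊑us ys⊑vs = subst (_⊑ _) (sym (concatMap-++ _ xs ys)) (Sublist.++⁺ xs⊑us ys⊑vs)

mutual
  ends-firstChildMatching-⊑ : ∀ p o t → ends (firstChildMatching p o t) ⊑ vertices o t
  ends-firstChildMatching-⊑ 0ℙ o (node [])              = o ∷ʳ []
  -- The first child is unfolded: its label suc o is used by the edge (o , suc o), and
  -- inside its subtree only its children's subtrees are matched.
  ends-firstChildMatching-⊑ 0ℙ o (node (node us ∷ ts)) =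
    refl ∷ (refl ∷ ends-++⁺ (forestFirstChildMatching 0ℙ (suc (suc o)) us)
      (ends-forestFirstChildMatching-⊑ 0ℙ (suc (suc o)) us)
      (ends-forestFirstChildMatching-⊑ 1ℙ (suc o + size (node us)) ts))
  ends-firstChildMatching-⊑ 1ℙ o (node ts) = o ∷ʳ ends-forestFirstChildMatching-⊑ 0ℙ (suc o) ts

  ends-forestFirstChildMatching-⊑ : ∀ p q ts → ends (forestFirstChildMatching p q ts) ⊑ forestVertices q ts
  ends-forestFirstChildMatching-⊑ p q []       = []
  ends-forestFirstChildMatching-⊑ p q (t ∷ ts) = ends-++⁺ (firstChildMatching p q t)
    (ends-firstChildMatching-⊑ p q t) (ends-forestFirstChildMatching-⊑ p (q + size t) ts)

data LeavesAtOddDepth : Parity → RTree → Set where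
  even-node : ∀ {t ts} → All (LeavesAtOddDepth 1ℙ) (t ∷ ts) → LeavesAtOddDepth 0ℙ (node (t ∷ ts))
  odd-node  : ∀ {ts} → All (LeavesAtOddDepth 0ℙ) ts → LeavesAtOddDepth 1ℙ (node ts)

mutual
  length-firstChildMatching : ∀ {p t} o → LeavesAtOddDepth p t →
    length (firstChildMatching p o t) ≡ length (evenVertices p o t)
  length-firstChildMatching o (even-node ts) = cong suc (length-forestFirstChildMatching (suc o) ts)
  length-firstChildMatching o (odd-node ts)  = length-forestFirstChildMatching (suc o) ts

  length-forestFirstChildMatching : ∀ {p ts} q → All (LeavesAtOddDepth p) ts →
    length (forestFirstChildMatching p q ts) ≡ length (forestEvenVertices p q ts)
  length-forestFirstChildMatching q [] = refl
  length-forestFirstChildMatching {p} {t ∷ ts} q (h ∷ hs) = begin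
    length (firstChildMatching p q t ++ forestFirstChildMatching p q′ ts)
      ≡⟨ length-++ (firstChildMatching p q t) ⟩
    length (firstChildMatching p q t) + length (forestFirstChildMatching p q′ ts)
      ≡⟨ cong₂ _+_ (length-firstChildMatching q h) (length-forestFirstChildMatching q′ hs) ⟩
    length (evenVertices p q t) + length (forestEvenVertices p q′ ts)
      ≡⟨ sym (length-++ (evenVertices p q t)) ⟩
    length (evenVertices p q t ++ forestEvenVertices p q′ ts)
      ∎
    where
      open ≡-Reasoning
      q′ : ℕ
      q′ = q + size t

firstChildMatching-isMatching : (t : RTree) →
  Σ[ M ∈ Matching (treeGraph t) ] ∣ M ∣ₘ ≡ length (firstChildMatching 0ℙ 0 t)
firstChildMatching-isMatching t = treeMatching t (firstChildMatching 0ℙ 0 t)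
  (firstChildMatching-⊆ 0ℙ 0 t)
  (Unique-resp-⊑ ends⊑vertices (Consecutive⇒Unique (vertices-consecutive 0 t)))
  (Sublist.All-resp-⊆ ends⊑vertices (Consecutive⇒< (vertices-consecutive 0 t)))
  where
    ends⊑vertices : ends (firstChildMatching 0ℙ 0 t) ⊑ vertices 0 t
    ends⊑vertices = ends-firstChildMatching-⊑ 0ℙ 0 t

deficiency-leavesAtOddDepth : ∀ {t} → LeavesAtOddDepth 0ℙ t →
  IsDeficiency (treeGraph t) (size t ∸ 2 * evenCount 0ℙ t)
deficiency-leavesAtOddDepth {t} leaves =
  subst (λ c → IsDeficiency (treeGraph t) (size t ∸ 2 * c)) (trans ∣M∣≡∣C∣ (length-evenVertices 0ℙ 0 t))
    (isDeficiency-of-cover M (evenVertices-cover t) ∣M∣≡∣C∣)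
  where
    M : Matching (treeGraph t)
    M = proj₁ (firstChildMatching-isMatching t)
    ∣M∣≡∣C∣ : ∣ M ∣ₘ ≡ length (evenVertices 0ℙ 0 t)
    ∣M∣≡∣C∣ = trans (proj₂ (firstChildMatching-isMatching t)) (length-firstChildMatching 0 leaves)

sizes-replicate : ∀ c x → sizes (replicate c x) ≡ c * size x
sizes-replicate zero    x = refl
sizes-replicate (suc c) x = cong (size x +_) (sizes-replicate c x)

forestEvenCount-replicate : ∀ p c x → forestEvenCount p (replicate c x) ≡ c * evenCount p x
forestEvenCount-replicate p zero    x = refl
forestEvenCount-replicate p (suc c) x = cong (evenCount p x +_) (forestEvenCount-replicate p c x)

-- r = #odd − #even + 1, stated without truncated subtraction.
HasExcess : RTree → ℕ → Set
HasExcess t r = size t + 1 ≡ 2 * evenCount 0ℙ t + r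

star-hasExcess : ∀ c → HasExcess (node (replicate c leaf)) c
star-hasExcess c = begin
  suc (sizes (replicate c leaf)) + 1                   ≡⟨ cong (λ s → suc s + 1) (sizes-replicate c leaf) ⟩
  suc (c * 1) + 1                                      ≡⟨ arithmetic c ⟩
  2 * suc (c * 0) + c                                  ≡⟨ cong (λ l → 2 * suc l + c) (sym (forestEvenCount-replicate 1ℙ c leaf)) ⟩
  2 * suc (forestEvenCount 1ℙ (replicate c leaf)) + c ∎
  where
    open ≡-Reasoning
    arithmetic : ∀ c → suc (c * 1) + 1 ≡ 2 * suc (c * 0) + c
    arithmetic = solve-∀

spider-hasExcess : ∀ c {x r} → HasExcess x r → HasExcess (node (replicate c (node [ x ]))) (c * r)
spider-hasExcess c {x} {r} x-excess = begin
  suc (sizes (replicate c (node [ x ]))) + 1           ≡⟨ cong (λ s → suc s + 1) (sizes-replicate c (node [ x ])) ⟩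
  suc (c * suc (size x + 0)) + 1                       ≡⟨ arithmetic₁ c (size x) ⟩
  2 + c * (size x + 1)                                 ≡⟨ cong (λ s → 2 + c * s) x-excess ⟩
  2 + c * (2 * evenCount 0ℙ x + r)                    ≡⟨ arithmetic₂ c (evenCount 0ℙ x) r ⟩
  2 * suc (c * (evenCount 0ℙ x + 0)) + c * r          ≡⟨ cong (λ l → 2 * suc l + c * r) (sym (forestEvenCount-replicate 1ℙ c (node [ x ]))) ⟩
  2 * suc (forestEvenCount 1ℙ (replicate c (node [ x ]))) + c * r ∎
  where
    open ≡-Reasoning
    arithmetic₁ : ∀ c s → suc (c * suc (s + 0)) + 1 ≡ 2 + c * (s + 1)
    arithmetic₁ = solve-∀
    arithmetic₂ : ∀ c l r → 2 + c * (2 * l + r) ≡ 2 * suc (c * (l + 0)) + c * r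
    arithmetic₂ = solve-∀

C-hasExcess : ∀ n j → HasExcess (C n j) ((n ∸ 2) ^ suc j)
C-hasExcess n zero    = subst (HasExcess (C n zero)) (sym (*-identityʳ (n ∸ 2))) (star-hasExcess (n ∸ 2))
C-hasExcess n (suc j) = spider-hasExcess (n ∸ 2) (C-hasExcess n j)

Tk-hasExcess : ∀ n k → HasExcess (Tk n k) ((n ∸ 1) * (n ∸ 2) ^ k)
Tk-hasExcess n zero    = subst (HasExcess (Tk n zero)) (sym (*-identityʳ (n ∸ 1))) (star-hasExcess (n ∸ 1))
Tk-hasExcess n (suc k) = spider-hasExcess (n ∸ 1) (C-hasExcess n k)

hasExcess⇒∸ : ∀ {t r} → HasExcess t r → size t ∸ 2 * evenCount 0ℙ t ≡ r ∸ 1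
hasExcess⇒∸ {t} {r} excess = begin
  size t ∸ 2 * e              ≡⟨ sym (cong₂ _∸_ (+-comm (size t) 1) (+-comm (2 * e) 1)) ⟩
  (size t + 1) ∸ (2 * e + 1)  ≡⟨ cong (_∸ (2 * e + 1)) excess ⟩
  (2 * e + r) ∸ (2 * e + 1)   ≡⟨ [m+n]∸[m+o]≡n∸o (2 * e) r 1 ⟩
  r ∸ 1                       ∎
  where
    open ≡-Reasoning
    e : ℕ
    e = evenCount 0ℙ t

node-replicate-leavesAtOddDepth : ∀ c {t} → LeavesAtOddDepth 1ℙ t → LeavesAtOddDepth 0ℙ (node (replicate (suc c) t))
node-replicate-leavesAtOddDepth c leaves = even-node (All.replicate⁺ (suc c) leaves)

C-leavesAtOddDepth : ∀ b j → LeavesAtOddDepth 0ℙ (C (3 + b) j)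
C-leavesAtOddDepth b zero    = node-replicate-leavesAtOddDepth b (odd-node [])
C-leavesAtOddDepth b (suc j) = node-replicate-leavesAtOddDepth b (odd-node (C-leavesAtOddDepth b j ∷ []))

Tk-leavesAtOddDepth : ∀ b k → LeavesAtOddDepth 0ℙ (Tk (3 + b) k)
Tk-leavesAtOddDepth b zero    = node-replicate-leavesAtOddDepth (suc b) (odd-node [])
Tk-leavesAtOddDepth b (suc k) = node-replicate-leavesAtOddDepth (suc b) (odd-node (C-leavesAtOddDepth b k ∷ []))

deficiency-Tk : ∀ {n} k → 3 ≤ n → IsDeficiency (treeGraph (Tk n k)) ((n ∸ 1) * (n ∸ 2) ^ k ∸ 1)
deficiency-Tk {suc (suc (suc b))} k (s≤s (s≤s (s≤s _))) =
  subst (IsDeficiency _) (hasExcess⇒∸ (Tk-hasExcess _ k)) (deficiency-leavesAtOddDepth (Tk-leavesAtOddDepth b k))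

-- m enters only through k = (m ∸ 3) / 2.
corollary1p6 : (m n : ℕ) → 3 ≤ m → m % 2 ≡ 1 → 3 < n →
    IsDeficiency (T m n) ((n ∸ 1) * (n ∸ 2) ^ ((m ∸ 3) / 2) ∸ 1)
corollary1p6 m n _ _ 3<n = deficiency-Tk ((m ∸ 3) / 2) (<⇒≤ 3<n)
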